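{- Consider a set of sporadic self-suspending tasks scheduled by a preemptive fixed-priority scheduler on a single processor, where each task has a unique priority. Let $\tau_i$ be a task whose worst-case response time is at most its period $T_i$. Then preventing the release of one job of $\tau_i$ (i.e., removing that job from the schedule) does not affect the schedule of any other job of $\tau_i$.
   Context: A sporadic self-suspending task $\tau_i$ releases a (possibly infinite) sequence of jobs; consecutive releases are separated by at least $T_i$ (the period / minimum inter-arrival time). Each job executes for at most $C_i$ time units and suspends itself for at most $S_i$ time units in total (possibly over several suspension intervals); while a job is suspended the processor may execute other jobs. Successive jobs of the same task execute in sequence. Under preemptive fixed-priority scheduling, at every instant the processor executes the ready (released, unfinished, not suspended) job of highest priority. The response time of a job is its finishing time minus its release time; the worst-case response time of a task is the maximum response time over all its jobs. -}

module Defs where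

open import Data.Nat using (ℕ; zero; suc; _+_; _≤_; _<ᵇ_; _≤ᵇ_; _≡ᵇ_)
open import Data.Fin using (Fin; _≟_)
open import Data.Bool using (Bool; true; false; if_then_else_; _∧_; not)
open import Data.List using (List; []; _∷_; allFin)
open import Data.Product using (_×_; _,_)
open import Data.Maybe using (Maybe; just; nothing; maybe)
open import Relation.Nullary.Decidable using (⌊_⌋)
open import Relation.Binary.PropositionalEquality using (_≡_)

-- Discrete-time model (time slots t = [t, t+1), t ∈ ℕ).
--
-- The behaviour of a job is a program: a list of segments (e , s) meaning
-- "execute e time units, then suspend s time units", in order.

Prog : Set
Prog = List (ℕ × ℕ)

execTotal : Prog → ℕ
execTotal [] = 0
execTotal ((e , s) ∷ p) = e + execTotal p

suspTotal : Prog → ℕ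
suspTotal [] = 0
suspTotal ((e , s) ∷ p) = s + suspTotal p

norm : Prog → Prog
norm [] = []
norm ((zero , zero) ∷ p) = norm p
norm ((zero , suc s) ∷ p) = (zero , suc s) ∷ p
norm ((suc e , s) ∷ p) = (suc e , s) ∷ p

-- status of a (normalised) remaining program
isFinished : Prog → Bool
isFinished [] = true
isFinished (_ ∷ _) = false

isReady : Prog → Bool
isReady ((suc e , s) ∷ p) = true
isReady _ = false

stepRun : Prog → Prog
stepRun ((suc e , s) ∷ p) = norm ((e , s) ∷ p)
stepRun p = p

stepSusp : Prog → Prog
stepSusp ((zero , suc s) ∷ p) = norm ((zero , s) ∷ p)
stepSusp p = p

-- Task sets: n sporadic self-suspending tasks with parameters C, S, T,
-- and unique (injective) fixed priorities; a SMALLER prio value means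
-- HIGHER priority.

record TaskSet (n : ℕ) : Set where
  field
    C S T    : Fin n → ℕ
    T-pos    : ∀ i → 1 ≤ T i
    prio     : Fin n → ℕ
    prio-inj : ∀ i j → prio i ≡ prio j → i ≡ j
open TaskSet public

-- Job sets: job k of task i has a (candidate) release time rel i k,
-- a flag saying whether it is actually released, and its program.
-- (Finite sequences / removed jobs = jobs whose flag is false.)

record JobSet (n : ℕ) : Set where
  field
    rel      : Fin n → ℕ → ℕ
    released : Fin n → ℕ → Bool
    prog     : Fin n → ℕ → Prog
open JobSet public

record Legal {n : ℕ} (τ : TaskSet n) (J : JobSet n) : Set where
  field
    sporadic : ∀ i k → rel J i k + T τ i ≤ rel J i (suc k)
    execOK   : ∀ i k → released J i k ≡ true → execTotal (prog J i k) ≤ C τ i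
    suspOK   : ∀ i k → released J i k ≡ true → suspTotal (prog J i k) ≤ S τ i

St : ℕ → Set
St n = Fin n → ℕ → Prog

search : (ℕ → Bool) → ℕ → ℕ → Maybe ℕ
search f k zero = nothing
search f k (suc m) = if f k then just k else search f (suc k) m

-- the current (active) job of task i at time t: the first released,
-- unfinished job with release ≤ t (jobs of a task execute in sequence).
-- Under sporadicity with T ≥ 1, rel i k ≥ k, so searching k ≤ t is exhaustive.
cand : ∀ {n} → JobSet n → St n → ℕ → Fin n → Maybe ℕ
cand J st t i =
  search (λ k → released J i k ∧ (rel J i k ≤ᵇ t) ∧ not (isFinished (st i k))) 0 (suc t)

readyTask : ∀ {n} → JobSet n → St n → ℕ → Fin n → Bool
readyTask J st t i = maybe (λ k → isReady (st i k)) false (cand J st t i)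

pick : ∀ {n} → (Fin n → ℕ) → (Fin n → Bool) → List (Fin n) → Maybe (Fin n)
pick prio ok [] = nothing
pick prio ok (i ∷ is) =
  if ok i
  then maybe (λ j → if prio i <ᵇ prio j then just i else just j) (just i) (pick prio ok is)
  else pick prio ok is

runTask : ∀ {n} → TaskSet n → JobSet n → St n → ℕ → Maybe (Fin n)
runTask {n} τ J st t = pick (prio τ) (readyTask J st t) (allFin n)

activeB : ∀ {n} → JobSet n → St n → ℕ → Fin n → ℕ → Bool
activeB J st t i k = maybe (λ k' → k' ≡ᵇ k) false (cand J st t i)

runsB : ∀ {n} → TaskSet n → JobSet n → St n → ℕ → Fin n → Bool
runsB τ J st t i = maybe (λ j → ⌊ j ≟ i ⌋) false (runTask τ J st t)

-- remaining (normalised) program of job k of task i at the start of slot t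
state : ∀ {n} → TaskSet n → JobSet n → ℕ → St n
state τ J zero i k = norm (prog J i k)
state τ J (suc t) i k =
  let st = state τ J t
      p  = st i k
  in if activeB J st t i k
     then (if runsB τ J st t i then stepRun p else stepSusp p)
     else p

Executes : ∀ {n} → TaskSet n → JobSet n → ℕ → Fin n → ℕ → Set
Executes τ J t i k =
  (activeB J (state τ J t) t i k ≡ true) × (runsB τ J (state τ J t) t i ≡ true)

FinishedBy : ∀ {n} → TaskSet n → JobSet n → ℕ → Fin n → ℕ → Set
FinishedBy τ J t i k = state τ J t i k ≡ []

WCRT≤ : ∀ {n} → TaskSet n → Fin n → ℕ → Set
WCRT≤ {n} τ i d =
  (J : JobSet n) → Legal τ J → ∀ k → released J i k ≡ true →
  FinishedBy τ J (rel J i k + d) i k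

removeJob : ∀ {n} → JobSet n → Fin n → ℕ → JobSet n
removeJob J i0 k0 = record
  { rel = rel J
  ; released = λ i k → if ⌊ i ≟ i0 ⌋ ∧ (k ≡ᵇ k0) then false else released J i k
  ; prog = prog J
  }

module Submission where

-- Write J′ for the job set with job k₀ of τᵢ removed.  By induction on time we
-- show that the states in J and J′ agree on all jobs of higher-priority tasks
-- and on all jobs k ≢ k₀ of τᵢ ('Agree').  Higher-priority tasks are unaffected
-- because the scheduler's choice for a task depends only on the readiness of
-- tasks of higher or equal priority ('pick-local').  For τᵢ, whenever job k₀
-- is still pending in J at time t, the WCRT bound gives t < rel k₀ + Tᵢ, and
-- sporadicity gives rel k₀ + Tᵢ ≤ rel k for every later job k; so no later
-- job is released yet and the current job of τᵢ in J′ is either the same as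
-- in J or absent while J runs k₀ ('search-drop').  Either way every job
-- k ≢ k₀ is active, runs and evolves identically in both schedules.

open import Defs
open import Data.Nat using (ℕ; zero; suc; _+_; _≤_; _<_; _≤ᵇ_; _<ᵇ_; _≡ᵇ_; _≤′_; _≤?_; ≤′-refl; ≤′-step)
import Data.Nat as ℕ
open import Data.Nat.Properties
  using (≤-refl; ≤-trans; ≤-antisym; <⇒≤; <-≤-trans; ≤-<-trans; <-irrefl; ≰⇒>; <⇒≱; ≮⇒≥;
         m≤m+n; m≤n⇒m<n∨m≡n; <ᵇ⇒<; ≤⇒≤′)
open import Data.Fin using (Fin; _≟_)
open import Data.Bool using (Bool; true; false; if_then_else_; _∧_; not)
open import Data.Bool.Properties using (⇔→≡; T-≡; ∧-zeroʳ)
open import Data.List using (List; []; _∷_; allFin)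
open import Data.List.Relation.Unary.Any using (here; there)
open import Data.List.Membership.Propositional using (_∈_)
open import Data.Maybe using (Maybe; just; nothing; maybe′)
open import Data.Product using (_×_; _,_; proj₁; proj₂)
open import Data.Sum using (_⊎_; inj₁; inj₂)
open import Relation.Nullary using (¬_; yes; no; contradiction)
open import Relation.Nullary.Decidable using (⌊_⌋; dec-true; dec-false)
open import Function.Bundles using (_⇔_; mk⇔; Equivalence)
open import Relation.Binary.PropositionalEquality
  using (_≡_; _≢_; refl; sym; trans; cong; cong₂)

≡ᵇ-refl : ∀ m → (m ≡ᵇ m) ≡ true
≡ᵇ-refl m = dec-true (m ℕ.≟ m) refl

≢⇒≡ᵇ-false : ∀ {m n} → m ≢ n → (m ≡ᵇ n) ≡ false
≢⇒≡ᵇ-false {m} {n} = dec-false (m ℕ.≟ n)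

>⇒≤ᵇ-false : ∀ {m n} → n < m → (m ≤ᵇ n) ≡ false
>⇒≤ᵇ-false {m} {n} n<m = dec-false (m ≤? n) (<⇒≱ n<m)

<⇒<ᵇ-true : ∀ {m n} → m < n → (m <ᵇ n) ≡ true
<⇒<ᵇ-true {m} {n} = dec-true (m ℕ.<? n)

<ᵇ-true⇒< : ∀ {m n} → (m <ᵇ n) ≡ true → m < n
<ᵇ-true⇒< {m} {n} e = <ᵇ⇒< m n (Equivalence.from T-≡ e)

search-cong : ∀ (f g : ℕ → Bool) → (∀ k → f k ≡ g k) → ∀ s m → search f s m ≡ search g s m
search-cong f g f≗g s zero = refl
search-cong f g f≗g s (suc m) rewrite f≗g s with g s
... | true  = refl
... | false = search-cong f g f≗g (suc s) m

search-sound : ∀ (f : ℕ → Bool) s m k → search f s m ≡ just k → f k ≡ true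
search-sound f s (suc m) k found with f s in fs
search-sound f s (suc m) .s refl | true = fs
... | false = search-sound f (suc s) m k found

search-none : ∀ (g : ℕ → Bool) s → (∀ k → s ≤ k → g k ≡ false) → ∀ m → search g s m ≡ nothing
search-none g s none zero = refl
search-none g s none (suc m) rewrite none s ≤-refl =
  search-none g (suc s) (λ k s<k → none k (<⇒≤ s<k)) m

SameOrDropped : ℕ → Maybe ℕ → Maybe ℕ → Set
SameOrDropped k₀ a b = (a ≡ b) ⊎ ((a ≡ just k₀) × (b ≡ nothing))

search-drop : ∀ (f g : ℕ → Bool) k₀ →
              (∀ k → k ≢ k₀ → f k ≡ g k) → g k₀ ≡ false →
              (f k₀ ≡ true → ∀ k → k₀ < k → g k ≡ false) →
              ∀ s m → SameOrDropped k₀ (search f s m) (search g s m)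
search-drop f g k₀ agree drop after s zero = inj₁ refl
search-drop f g k₀ agree drop after s (suc m) with s ℕ.≟ k₀
... | no s≢k₀ rewrite agree s s≢k₀ with g s
...   | true  = inj₁ refl
...   | false = search-drop f g k₀ agree drop after (suc s) m
search-drop f g k₀ agree drop after s (suc m) | yes refl rewrite drop = at-k₀ (f s) refl
  where
  at-k₀ : ∀ b → f s ≡ b →
          SameOrDropped s (if b then just s else search f (suc s) m) (search g (suc s) m)
  at-k₀ true  fs = inj₂ (refl , search-none g (suc s) (after fs) m)
  at-k₀ false _  = search-drop f g k₀ agree drop after (suc s) m

module Selection {n : ℕ} (prio : Fin n → ℕ) where

  IsHighest : (Fin n → Bool) → List (Fin n) → Fin n → Set
  IsHighest ok l z = z ∈ l × ok z ≡ true × (∀ y → y ∈ l → ok y ≡ true → prio z ≤ prio y)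

  highest-head : ∀ {ok x xs} → ok x ≡ true →
                 (∀ y → y ∈ xs → ok y ≡ true → prio x ≤ prio y) → IsHighest ok (x ∷ xs) x
  highest-head okx min = here refl , okx , λ
    { _ (here refl) _ → ≤-refl
    ; y (there y∈) oky → min y y∈ oky }

  highest-tail : ∀ {ok x xs z} → (ok x ≡ true → prio z ≤ prio x) →
                 IsHighest ok xs z → IsHighest ok (x ∷ xs) z
  highest-tail beats (z∈ , okz , min) = there z∈ , okz , λ
    { _ (here refl) okx → beats okx
    ; y (there y∈) oky → min y y∈ oky }

  pick-none : ∀ ok l → pick prio ok l ≡ nothing → ∀ y → y ∈ l → ok y ≡ false
  pick-none ok (x ∷ xs) eq y y∈ with ok x in okx
  pick-none ok (x ∷ xs) eq y y∈ | true with pick prio ok xs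
  pick-none ok (x ∷ xs) () y y∈ | true | nothing
  pick-none ok (x ∷ xs) eq y y∈ | true | just j with prio x <ᵇ prio j
  pick-none ok (x ∷ xs) () y y∈ | true | just j | true
  pick-none ok (x ∷ xs) () y y∈ | true | just j | false
  pick-none ok (x ∷ xs) eq .x (here refl) | false = okx
  pick-none ok (x ∷ xs) eq y (there y∈)   | false = pick-none ok xs eq y y∈

  pick-sound : ∀ ok l z → pick prio ok l ≡ just z → IsHighest ok l z
  pick-sound ok (x ∷ xs) z eq with ok x in okx | pick prio ok xs in rest
  ... | false | _ = highest-tail (λ okx′ → contradiction (trans (sym okx′) okx) λ ())
                                 (pick-sound ok xs z (trans rest eq))
  ... | true | nothing with refl ← eq =
    highest-head okx (λ y y∈ oky → contradiction (trans (sym oky) (pick-none ok xs rest y y∈)) λ ())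
  ... | true | just w with prio x <ᵇ prio w in cmp
  ...   | true with refl ← eq =
    highest-head okx (λ y y∈ oky → ≤-trans (<⇒≤ (<ᵇ-true⇒< cmp))
                                           (proj₂ (proj₂ (pick-sound ok xs w rest)) y y∈ oky))
  ...   | false with refl ← eq =
    highest-tail (λ _ → ≮⇒≥ (λ x<w → contradiction (trans (sym (<⇒<ᵇ-true x<w)) cmp) λ ()))
                 (pick-sound ok xs w rest)

  module _ (prio-inj : ∀ a b → prio a ≡ prio b → a ≡ b) where

    highest-unique : ∀ {ok l z w} → IsHighest ok l z → IsHighest ok l w → z ≡ w
    highest-unique (z∈ , okz , minz) (w∈ , okw , minw) =
      prio-inj _ _ (≤-antisym (minz _ w∈ okw) (minw _ z∈ okz))

    pick-complete : ∀ ok l z → IsHighest ok l z → pick prio ok l ≡ just z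
    pick-complete ok l z high@(z∈ , okz , _) with pick prio ok l in found
    ... | nothing = contradiction (trans (sym okz) (pick-none ok l found z z∈)) λ ()
    ... | just w  = cong just (highest-unique (pick-sound ok l w found) high)

    pick-local : ∀ ok ok′ l x → (∀ y → prio y ≤ prio x → ok y ≡ ok′ y) →
                 pick prio ok l ≡ just x → pick prio ok′ l ≡ just x
    pick-local ok ok′ l x agree found =
      pick-complete ok′ l x (x∈ , trans (sym (agree x ≤-refl)) okx , min′)
      where
      high = pick-sound ok l x found
      x∈ = proj₁ high
      okx = proj₁ (proj₂ high)
      min′ : ∀ y → y ∈ l → ok′ y ≡ true → prio x ≤ prio y
      min′ y y∈ ok′y with prio x ≤? prio y
      ... | yes x≤y = x≤y
      ... | no  x≰y = proj₂ (proj₂ high) y y∈ (trans (agree y (<⇒≤ (≰⇒> x≰y))) ok′y)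

open Selection using (pick-local)

-- One slot of evolution of a job: the case analysis in the definition of 'state'.
advance : Bool → Bool → Prog → Prog
advance active runs p = if active then (if runs then stepRun p else stepSusp p) else p

advance-[] : ∀ active runs → advance active runs [] ≡ []
advance-[] true  true  = refl
advance-[] true  false = refl
advance-[] false _     = refl

advance-cong : ∀ {a a′ r r′ p p′} → a ≡ a′ → (a ≡ true → r ≡ r′) → p ≡ p′ →
               advance a r p ≡ advance a′ r′ p′
advance-cong {true}  {p = p} refl same-run refl = cong (λ r → advance true r p) (same-run refl)
advance-cong {false} refl _        refl = refl

finished-mono : ∀ {n} (τ : TaskSet n) J i k {t u} → t ≤′ u →
                FinishedBy τ J t i k → FinishedBy τ J u i k
finished-mono τ J i k ≤′-refl done = done
finished-mono τ J i k (≤′-step {u} t≤u) done =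
  trans (cong (advance active runs) (finished-mono τ J i k t≤u done)) (advance-[] active runs)
  where
  active = activeB J (state τ J u) u i k
  runs   = runsB τ J (state τ J u) u i

sporadic-gap : ∀ (r : ℕ → ℕ) T → (∀ k → r k + T ≤ r (suc k)) →
               ∀ {k₀ k} → k₀ < k → r k₀ + T ≤ r k
sporadic-gap r T gap k₀<k = go (≤⇒≤′ k₀<k)
  where
  go : ∀ {k₀ k} → suc k₀ ≤′ k → r k₀ + T ≤ r k
  go ≤′-refl = gap _
  go (≤′-step {k} k₀<k) = ≤-trans (go k₀<k) (≤-trans (m≤m+n (r k) T) (gap k))

removeJob-other : ∀ {n} (J : JobSet n) i₀ k₀ j k → ¬ (j ≡ i₀ × k ≡ k₀) →
                  released (removeJob J i₀ k₀) j k ≡ released J j k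
removeJob-other J i₀ k₀ j k other with j ≟ i₀
... | no  _    = refl
... | yes refl rewrite ≢⇒≡ᵇ-false (λ k≡k₀ → other (refl , k≡k₀)) = refl

removeJob-removed : ∀ {n} (J : JobSet n) i₀ k₀ → released (removeJob J i₀ k₀) i₀ k₀ ≡ false
removeJob-removed J i₀ k₀ with i₀ ≟ i₀
... | yes _ rewrite ≡ᵇ-refl k₀ = refl
... | no  i₀≢i₀ = contradiction refl i₀≢i₀

pending : ∀ {n} → JobSet n → St n → ℕ → Fin n → ℕ → Bool
pending K st t j k = released K j k ∧ ((rel K j k ≤ᵇ t) ∧ not (isFinished (st j k)))

pending-sound : ∀ {n} (K : JobSet n) st t j k → pending K st t j k ≡ true →
                (released K j k ≡ true) × (st j k ≢ [])
pending-sound K st t j k p with released K j k | rel K j k ≤ᵇ t | st j k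
... | true  | true  | _ ∷ _ = refl , λ ()
... | true  | true  | []    = contradiction p λ ()
... | true  | false | _     = contradiction p λ ()
... | false | _     | _     = contradiction p λ ()

pending-future : ∀ {n} (K : JobSet n) st t j k → t < rel K j k → pending K st t j k ≡ false
pending-future K st t j k t<rel rewrite >⇒≤ᵇ-false t<rel = ∧-zeroʳ (released K j k)

maybe′-cong : ∀ {A : Set} {f g : A → Bool} {c c′ : Maybe A} → c ≡ c′ →
              (∀ a → c′ ≡ just a → f a ≡ g a) → maybe′ f false c ≡ maybe′ g false c′
maybe′-cong {c = nothing} refl f≗g = refl
maybe′-cong {c = just a}  refl f≗g = f≗g a refl

runs-picks : ∀ {n} (r : Maybe (Fin n)) x → maybe′ (λ j → ⌊ j ≟ x ⌋) false r ≡ true ⇔ r ≡ just x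
runs-picks r x = mk⇔ (to r) from
  where
  from : r ≡ just x → maybe′ (λ j → ⌊ j ≟ x ⌋) false r ≡ true
  from refl with x ≟ x
  ... | yes _   = refl
  ... | no  x≢x = contradiction refl x≢x

  to : ∀ r → maybe′ (λ j → ⌊ j ≟ x ⌋) false r ≡ true → r ≡ just x
  to (just j) e with j ≟ x
  ... | yes refl = refl
  to (just j) () | no _

module Removal {n : ℕ} (τ : TaskSet n) (i : Fin n) (wcrt : WCRT≤ τ i (T τ i))
               (J : JobSet n) (legal : Legal τ J) (k₀ : ℕ) where

  J′ : JobSet n
  J′ = removeJob J i k₀

  record Agree (t : ℕ) : Set where
    field
      higher : ∀ j → prio τ j < prio τ i → ∀ k → state τ J t j k ≡ state τ J′ t j k
      own    : ∀ k → k ≢ k₀ → state τ J t i k ≡ state τ J′ t i k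
  open Agree

  higher⇒≢ : ∀ {j} → prio τ j < prio τ i → j ≢ i
  higher⇒≢ j<i refl = <-irrefl refl j<i

  pending-cong : ∀ st st′ t j k → released J j k ≡ released J′ j k → st j k ≡ st′ j k →
                 pending J st t j k ≡ pending J′ st′ t j k
  pending-cong st st′ t j k same-rel same-st =
    cong₂ (λ r p → r ∧ ((rel J j k ≤ᵇ t) ∧ not (isFinished p))) same-rel same-st

  module Slot (t : ℕ) (agree : Agree t) where
    st st′ : St n
    st  = state τ J t
    st′ = state τ J′ t

    cand-higher : ∀ j → prio τ j < prio τ i → cand J st t j ≡ cand J′ st′ t j
    cand-higher j j<i = search-cong _ _
      (λ k → pending-cong st st′ t j k
               (sym (removeJob-other J i k₀ j k (λ (j≡i , _) → higher⇒≢ j<i j≡i)))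
               (higher agree j j<i k))
      0 (suc t)

    ready-higher : ∀ j → prio τ j < prio τ i → readyTask J st t j ≡ readyTask J′ st′ t j
    ready-higher j j<i =
      maybe′-cong (cand-higher j j<i) (λ k _ → cong isReady (higher agree j j<i k))

    runs-agree : ∀ x → (∀ y → prio τ y ≤ prio τ x → readyTask J st t y ≡ readyTask J′ st′ t y) →
                 runsB τ J st t x ≡ runsB τ J′ st′ t x
    runs-agree x same-ready =
      ⇔→≡ (mk⇔ (transfer J st J′ st′ same-ready)
                (transfer J′ st′ J st (λ y y≤x → sym (same-ready y y≤x))))
      where
      transfer : ∀ K s K′ s′ → (∀ y → prio τ y ≤ prio τ x → readyTask K s t y ≡ readyTask K′ s′ t y) →
                 runsB τ K s t x ≡ true → runsB τ K′ s′ t x ≡ true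
      transfer K s K′ s′ same runs =
        Equivalence.from (runs-picks _ x)
          (pick-local (prio τ) (prio-inj τ) (readyTask K s t) (readyTask K′ s′ t) (allFin n) x same
                      (Equivalence.to (runs-picks _ x) runs))

    -- The WCRT bound: while job k₀ is pending in J, its deadline rel k₀ + Tᵢ
    -- has not passed, hence no later job of τᵢ has been released.
    k₀-pending-early : pending J st t i k₀ ≡ true → t < rel J i k₀ + T τ i
    k₀-pending-early pend with rel J i k₀ + T τ i ≤? t
    ... | no  t≱deadline = ≰⇒> t≱deadline
    ... | yes deadline≤t = contradiction (finished-mono τ J i k₀ (≤⇒≤′ deadline≤t) (wcrt J legal k₀ released₀))
                                         unfinished
      where
      released₀  = proj₁ (pending-sound J st t i k₀ pend)
      unfinished = proj₂ (pending-sound J st t i k₀ pend)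

    later-not-pending : pending J st t i k₀ ≡ true → ∀ k → k₀ < k → pending J′ st′ t i k ≡ false
    later-not-pending pend k k₀<k = pending-future J′ st′ t i k
      (<-≤-trans (k₀-pending-early pend) (sporadic-gap (rel J i) (T τ i) (Legal.sporadic legal i) k₀<k))

    k₀-not-pending′ : pending J′ st′ t i k₀ ≡ false
    k₀-not-pending′ =
      cong (λ r → r ∧ ((rel J i k₀ ≤ᵇ t) ∧ not (isFinished (st′ i k₀)))) (removeJob-removed J i k₀)

    cand-own : SameOrDropped k₀ (cand J st t i) (cand J′ st′ t i)
    cand-own = search-drop (pending J st t i) (pending J′ st′ t i) k₀
      (λ k k≢k₀ → pending-cong st st′ t i k
                    (sym (removeJob-other J i k₀ i k (λ (_ , k≡k₀) → k≢k₀ k≡k₀)))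
                    (own agree k k≢k₀))
      k₀-not-pending′ later-not-pending 0 (suc t)

    cand′-avoids-k₀ : ∀ {k} → cand J′ st′ t i ≡ just k → k ≢ k₀
    cand′-avoids-k₀ {k} found refl =
      contradiction (trans (sym (search-sound (pending J′ st′ t i) 0 (suc t) k found)) k₀-not-pending′)
                    λ ()

    ready-upto-own : cand J st t i ≡ cand J′ st′ t i →
                     ∀ y → prio τ y ≤ prio τ i → readyTask J st t y ≡ readyTask J′ st′ t y
    ready-upto-own same-cand y y≤i with m≤n⇒m<n∨m≡n y≤i
    ... | inj₁ y<i = ready-higher y y<i
    ... | inj₂ y≡i with prio-inj τ y i y≡i
    ...   | refl = maybe′-cong same-cand (λ k found → cong isReady (own agree k (cand′-avoids-k₀ found)))

    own-step : ∀ k → k ≢ k₀ →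
               (activeB J st t i k ≡ activeB J′ st′ t i k) ×
               (activeB J st t i k ≡ true → runsB τ J st t i ≡ runsB τ J′ st′ t i)
    own-step k k≢k₀ with cand-own
    ... | inj₁ same-cand =
      maybe′-cong same-cand (λ _ _ → refl) , λ _ → runs-agree i (ready-upto-own same-cand)
    ... | inj₂ (runs-k₀ , none′) = trans inactive (sym (cong (maybe′ (_≡ᵇ k) false) none′)) ,
                                   λ active → contradiction (trans (sym active) inactive) λ ()
      where
      inactive : activeB J st t i k ≡ false
      inactive = trans (cong (maybe′ (_≡ᵇ k) false) runs-k₀) (≢⇒≡ᵇ-false (λ k₀≡k → k≢k₀ (sym k₀≡k)))

    agree-suc : Agree (suc t)
    agree-suc .higher j j<i k =
      advance-cong (cong (maybe′ (_≡ᵇ k) false) (cand-higher j j<i))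
                   (λ _ → runs-agree j (λ y y≤j → ready-higher y (≤-<-trans y≤j j<i)))
                   (higher agree j j<i k)
    agree-suc .own k k≢k₀ =
      advance-cong (proj₁ (own-step k k≢k₀)) (proj₂ (own-step k k≢k₀)) (own agree k k≢k₀)

  agree : ∀ t → Agree t
  agree zero    = record { higher = λ _ _ _ → refl ; own = λ _ _ → refl }
  agree (suc t) = Slot.agree-suc t (agree t)

lemma1 : ∀ {n} (τ : TaskSet n) (i : Fin n) → WCRT≤ τ i (T τ i) →
         (J : JobSet n) → Legal τ J → (k0 : ℕ) →
         ∀ t k → k ≢ k0 →
         (Executes τ J t i k ⇔ Executes τ (removeJob J i k0) t i k)
         × (state τ J t i k ≡ state τ (removeJob J i k0) t i k)
lemma1 τ i wcrt J legal k0 t k k≢k0 = mk⇔ forth back , Agree.own (agree t) k k≢k0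
  where
  open Removal τ i wcrt J legal k0
  same-active = proj₁ (Slot.own-step t (agree t) k k≢k0)
  same-runs   = proj₂ (Slot.own-step t (agree t) k k≢k0)

  forth : Executes τ J t i k → Executes τ J′ t i k
  forth (active , runs) = trans (sym same-active) active , trans (sym (same-runs active)) runs

  back : Executes τ J′ t i k → Executes τ J t i k
  back (active′ , runs′) = active , trans (same-runs active) runs′
    where active = trans same-active active′
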